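{- Let $\mathcal{C}^+$ be the vector space over a field $\mathbb{K}$ with basis $(\mathbf{P}^\pi)$ indexed by the nonempty nondecreasing parking functions $\pi$, equipped with the two bilinear products $$\mathbf{P}^\alpha\succ\mathbf{P}^\beta=\mathbf{P}^{\alpha\bullet\beta},\qquad \mathbf{P}^\alpha\prec\mathbf{P}^\beta=\mathbf{P}^{\alpha\circ\beta}.$$ Then $(\mathcal{C}^+,\prec,\succ)$ is a duplicial algebra, and it is the free duplicial algebra on the single generator $x=\mathbf{P}^1$. That is, the duplicial algebra morphism from the free duplicial algebra on one generator to $\mathcal{C}^+$ sending the generator to $\mathbf{P}^1$ is an isomorphism.
   Context: A nondecreasing parking function of length $n$ is a nondecreasing word $\pi=\pi_1\cdots\pi_n$ over the positive integers such that $\pi_i\le i$ for all $i$. A parking function is any rearrangement of such a word. For a word $\beta$ and an integer $k$, $\beta[k]$ denotes the word obtained by adding $k$ to every letter of $\beta$. For nondecreasing parking functions $\alpha$ of length $k$ and $\beta$, set $\alpha\bullet\beta=\alpha\cdot\beta[k]$, where $\cdot$ is concatenation. Set also $\alpha\circ\beta=\alpha\cdot\beta[\max(\alpha)-1]$. For example $12\bullet113=12335$ and $12\circ 113=12224$. In the paper, $\mathbf{P}^\pi=\sum_{\mathbf{a}^\uparrow=\pi}\mathbf{F}_\mathbf{a}$ is a basis of the Hopf subalgebra $\mathbf{CQSym}$ of the Hopf algebra $\mathbf{PQSym}$ of parking functions, where $\mathbf{a}^\uparrow$ is the nondecreasing rearrangement of $\mathbf{a}$. In this basis the usual product of $\mathbf{CQSym}$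 is $\mathbf{P}^\alpha\mathbf{P}^\beta=\mathbf{P}^{\alpha\bullet\beta}$, and it is denoted $\succ$. A duplicial algebra is a vector space with two associative bilinear operations $\prec,\succ$ satisfying $(x\succ y)\prec z=x\succ(y\prec z)$. -}

module Defs where

open import Level using (Level) renaming (suc to lsuc; _⊔_ to _⊔ℓ_)
open import Data.Nat using (ℕ; zero; suc; _+_; _∸_; _⊔_; _≤_; z≤n; s≤s)
  renaming (_≟_ to _≟ℕ_)
open import Data.Nat.Properties
open import Data.List using (List; []; _∷_; _++_; map; length; foldr; cartesianProductWith)
open import Data.List.Properties using (≡-dec)
open import Data.Product using (Σ; ∃; _×_; _,_; proj₁; proj₂)
open import Data.Unit using (⊤; tt)
open import Relation.Nullary using (¬_; yes; no)
open import Relation.Binary.PropositionalEquality using (_≡_; refl; subst; sym)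
open import Relation.Binary.Core using (Rel)
open import Algebra.Bundles using (CommutativeRing)
open import Algebra.Module.Bundles.Raw using (RawModule)
open import Algebra.Module.Structures using (IsModule)
open import Algebra.Module.Morphism.Structures using (module ModuleMorphisms)

record Field (c ℓ : Level) : Set (lsuc (c ⊔ℓ ℓ)) where
  field
    commutativeRing : CommutativeRing c ℓ
  open CommutativeRing commutativeRing public
  field
    0≉1     : ¬ (0# ≈ 1#)
    inverse : ∀ x → ¬ (x ≈ 0#) → ∃ λ y → (x * y) ≈ 1#

-- NDPF-from p i w : the word w, whose first letter sits at position i,
-- is nondecreasing, its letters are ≥ p (p = previous letter) and its
-- letter at position j is ≤ j.

NDPF-from : ℕ → ℕ → List ℕ → Set
NDPF-from p i []       = ⊤
NDPF-from p i (x ∷ xs) = p ≤ x × x ≤ i × NDPF-from x (suc i) xs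

IsNDPF : List ℕ → Set
IsNDPF w = NDPF-from 1 1 w

record NDPF : Set where
  constructor ndpf
  field
    word     : List ℕ
    isNDPF   : IsNDPF word
    nonEmpty : ¬ (word ≡ [])
open NDPF public

shift : ℕ → List ℕ → List ℕ
shift k = map (k +_)

-- max of a word (max [] = 0, never used on empty words)
maxW : List ℕ → ℕ
maxW = foldr _⊔_ 0

_•w_ : List ℕ → List ℕ → List ℕ
α •w β = α ++ shift (length α) β

_∘w_ : List ℕ → List ℕ → List ℕ
α ∘w β = α ++ shift (maxW α ∸ 1) β

lastOr : ℕ → List ℕ → ℕ
lastOr p []       = p
lastOr p (x ∷ xs) = lastOr x xs

private
  okWeaken : ∀ {p q i j} w → q ≤ p → i ≤ j → NDPF-from p i w → NDPF-from q j w
  okWeaken []       _   _   _              = tt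
  okWeaken (x ∷ xs) q≤p i≤j (p≤x , x≤i , r) =
    ≤-trans q≤p p≤x , ≤-trans x≤i i≤j , okWeaken xs ≤-refl (s≤s i≤j) r

  okShift : ∀ k {p i} w → NDPF-from p i w → NDPF-from (k + p) (k + i) (shift k w)
  okShift k []       _              = tt
  okShift k {p} {i} (x ∷ xs) (p≤x , x≤i , r) =
    +-monoʳ-≤ k p≤x , +-monoʳ-≤ k x≤i ,
    subst (λ j → NDPF-from (k + x) j (shift k xs)) (+-suc k i) (okShift k xs r)

  okApp : ∀ {p i} α γ → NDPF-from p i α →
          NDPF-from (lastOr p α) (length α + i) γ → NDPF-from p i (α ++ γ)
  okApp []       γ _              g = g
  okApp {p} {i} (x ∷ xs) γ (p≤x , x≤i , r) g =
    p≤x , x≤i , okApp xs γ r (subst (λ j → NDPF-from (lastOr x xs) j γ) (sym (+-suc (length xs) i)) g)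

  lastBound : ∀ {p i} α → p ≤ i → NDPF-from p i α → lastOr p α ≤ length α + i
  lastBound []       p≤i _ = p≤i
  lastBound {p} {i} (x ∷ xs) _ (_ , x≤i , r) =
    subst (lastOr x xs ≤_) (+-suc (length xs) i) (lastBound xs (≤-trans x≤i (n≤1+n i)) r)

  lastMax : ∀ p α → lastOr p α ≤ p ⊔ maxW α
  lastMax p []       = m≤m⊔n p 0
  lastMax p (x ∷ xs) = ≤-trans (lastMax x xs)
    (⊔-lub (≤-trans (m≤m⊔n x (maxW xs)) (m≤n⊔m p _)) (≤-trans (m≤n⊔m x (maxW xs)) (m≤n⊔m p _)))

  aux : ∀ n → n ≤ suc (Data.Nat.pred n)
  aux zero    = z≤n
  aux (suc n) = ≤-refl

  maxBound : ∀ {p} i α → NDPF-from p i α → maxW α ≤ length α + Data.Nat.pred i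
  maxBound i []       _ = z≤n
  maxBound i (x ∷ xs) (_ , x≤i , r) =
    ⊔-lub (≤-trans x≤i (≤-trans (aux i) (s≤s (m≤n+m _ (length xs)))))
          (≤-trans (maxBound (suc i) xs r)
             (≤-trans (+-monoʳ-≤ (length xs) (aux i)) (≤-reflexive (+-suc (length xs) _))))

  one⊔ : ∀ m → 1 ⊔ m ≤ (m ∸ 1) + 1
  one⊔ zero    = ≤-refl
  one⊔ (suc m) = ≤-reflexive (sym (+-comm m 1))

  ++-ne : ∀ (α γ : List ℕ) → ¬ (α ≡ []) → ¬ (α ++ γ ≡ [])
  ++-ne []       γ ne _  = ne refl
  ++-ne (x ∷ α) γ ne ()

•-isNDPF : ∀ α β → IsNDPF α → IsNDPF β → IsNDPF (α •w β)
•-isNDPF α β a b =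
  okApp α (shift (length α) β) a
    (okWeaken (shift (length α) β) (lastBound α ≤-refl a) ≤-refl (okShift (length α) β b))

∘-isNDPF : ∀ α β → IsNDPF α → IsNDPF β → IsNDPF (α ∘w β)
∘-isNDPF α β a b =
  okApp α (shift (maxW α ∸ 1) β) a
    (okWeaken (shift (maxW α ∸ 1) β)
       (≤-trans (lastMax 1 α) (one⊔ (maxW α)))
       (+-monoˡ-≤ 1 (≤-trans (m∸n≤m (maxW α) 1)
                      (≤-trans (maxBound 1 α a) (≤-reflexive (+-identityʳ (length α))))))
       (okShift (maxW α ∸ 1) β b))

_•_ : NDPF → NDPF → NDPF
α • β = ndpf (word α •w word β) (•-isNDPF (word α) (word β) (isNDPF α) (isNDPF β))
             (++-ne (word α) _ (nonEmpty α))

_∘_ : NDPF → NDPF → NDPF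
α ∘ β = ndpf (word α ∘w word β) (∘-isNDPF (word α) (word β) (isNDPF α) (isNDPF β))
             (++-ne (word α) _ (nonEmpty α))

𝟙 : NDPF
𝟙 = ndpf (1 ∷ []) (≤-refl , ≤-refl , tt) (λ ())

module _ {c ℓ : Level} (K : Field c ℓ) where
  open Field K renaming (_+_ to _+K_; _*_ to _*K_; -_ to -K_)

  record RawDuplicial (m ℓm : Level) : Set (c ⊔ℓ lsuc (m ⊔ℓ ℓm)) where
    infixl 7 _≺_ _≻_
    field
      rawModule : RawModule Carrier m ℓm
    open RawModule rawModule public
    field
      _≺_ : Carrierᴹ → Carrierᴹ → Carrierᴹ
      _≻_ : Carrierᴹ → Carrierᴹ → Carrierᴹ

  record IsDuplicialAlgebra {m ℓm} (D : RawDuplicial m ℓm) : Set (c ⊔ℓ ℓ ⊔ℓ m ⊔ℓ ℓm) where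
    open RawDuplicial D
    field
      isModule   : IsModule commutativeRing _≈ᴹ_ _+ᴹ_ 0ᴹ -ᴹ_ _*ₗ_ _*ᵣ_
      ≺-cong     : ∀ {x x′ y y′} → x ≈ᴹ x′ → y ≈ᴹ y′ → (x ≺ y) ≈ᴹ (x′ ≺ y′)
      ≻-cong     : ∀ {x x′ y y′} → x ≈ᴹ x′ → y ≈ᴹ y′ → (x ≻ y) ≈ᴹ (x′ ≻ y′)
      ≺-distribˡ : ∀ x y z → (x ≺ (y +ᴹ z)) ≈ᴹ ((x ≺ y) +ᴹ (x ≺ z))
      ≺-distribʳ : ∀ x y z → ((y +ᴹ z) ≺ x) ≈ᴹ ((y ≺ x) +ᴹ (z ≺ x))
      ≺-scaleˡ   : ∀ k x y → ((k *ₗ x) ≺ y) ≈ᴹ (k *ₗ (x ≺ y))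
      ≺-scaleʳ   : ∀ k x y → (x ≺ (k *ₗ y)) ≈ᴹ (k *ₗ (x ≺ y))
      ≻-distribˡ : ∀ x y z → (x ≻ (y +ᴹ z)) ≈ᴹ ((x ≻ y) +ᴹ (x ≻ z))
      ≻-distribʳ : ∀ x y z → ((y +ᴹ z) ≻ x) ≈ᴹ ((y ≻ x) +ᴹ (z ≻ x))
      ≻-scaleˡ   : ∀ k x y → ((k *ₗ x) ≻ y) ≈ᴹ (k *ₗ (x ≻ y))
      ≻-scaleʳ   : ∀ k x y → (x ≻ (k *ₗ y)) ≈ᴹ (k *ₗ (x ≻ y))
      ≺-assoc    : ∀ x y z → ((x ≺ y) ≺ z) ≈ᴹ (x ≺ (y ≺ z))
      ≻-assoc    : ∀ x y z → ((x ≻ y) ≻ z) ≈ᴹ (x ≻ (y ≻ z))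
      ≻≺-assoc   : ∀ x y z → ((x ≻ y) ≺ z) ≈ᴹ (x ≻ (y ≺ z))

  record DuplicialAlgebra (m ℓm : Level) : Set (c ⊔ℓ ℓ ⊔ℓ lsuc (m ⊔ℓ ℓm)) where
    field
      rawDuplicial       : RawDuplicial m ℓm
      isDuplicialAlgebra : IsDuplicialAlgebra rawDuplicial
    open RawDuplicial rawDuplicial public
    open IsDuplicialAlgebra isDuplicialAlgebra public

  record IsDuplicialMorphism {m₁ ℓm₁ m₂ ℓm₂}
           (D₁ : RawDuplicial m₁ ℓm₁) (D₂ : RawDuplicial m₂ ℓm₂)
           (f : RawDuplicial.Carrierᴹ D₁ → RawDuplicial.Carrierᴹ D₂)
           : Set (c ⊔ℓ m₁ ⊔ℓ ℓm₁ ⊔ℓ ℓm₂) where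
    private
      module D₁ = RawDuplicial D₁
      module D₂ = RawDuplicial D₂
    field
      isLinear : ModuleMorphisms.IsModuleHomomorphism D₁.rawModule D₂.rawModule f
      ≺-homo   : ∀ x y → f (x D₁.≺ y) D₂.≈ᴹ (f x D₂.≺ f y)
      ≻-homo   : ∀ x y → f (x D₁.≻ y) D₂.≈ᴹ (f x D₂.≻ f y)

  IsFreeDuplicialOn : ∀ {m ℓm} (D : RawDuplicial m ℓm) (g : RawDuplicial.Carrierᴹ D)
                      (a ℓa : Level) → Set (c ⊔ℓ ℓ ⊔ℓ m ⊔ℓ ℓm ⊔ℓ lsuc (a ⊔ℓ ℓa))
  IsFreeDuplicialOn D g a ℓa =
    (A : DuplicialAlgebra a ℓa) (x : DuplicialAlgebra.Carrierᴹ A) →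
    Σ (RawDuplicial.Carrierᴹ D → DuplicialAlgebra.Carrierᴹ A) λ f →
      IsDuplicialMorphism D (DuplicialAlgebra.rawDuplicial A) f ×
      DuplicialAlgebra._≈ᴹ_ A (f g) x ×
      ((h : RawDuplicial.Carrierᴹ D → DuplicialAlgebra.Carrierᴹ A) →
        IsDuplicialMorphism D (DuplicialAlgebra.rawDuplicial A) h →
        DuplicialAlgebra._≈ᴹ_ A (h g) x →
        ∀ y → DuplicialAlgebra._≈ᴹ_ A (h y) (f y))

  -- The space C⁺ with basis (P^π), π a nonempty nondecreasing parking
  -- function: an element is a finite formal K-linear combination
  -- Σ cᵢ P^{πᵢ}, represented by the list of pairs (cᵢ , πᵢ); two such
  -- are equal when all their coefficients agree.

  C⁺-Carrier : Set c
  C⁺-Carrier = List (Carrier × NDPF)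

  coeff : C⁺-Carrier → NDPF → Carrier
  coeff []             π = 0#
  coeff ((a , σ) ∷ xs) π with ≡-dec _≟ℕ_ (word σ) (word π)
  ... | yes _ = a +K coeff xs π
  ... | no  _ = coeff xs π

  P : NDPF → C⁺-Carrier
  P π = (1# , π) ∷ []

  bilin : (NDPF → NDPF → NDPF) → C⁺-Carrier → C⁺-Carrier → C⁺-Carrier
  bilin op = cartesianProductWith (λ { (a , α) (b , β) → (a *K b , op α β) })

  C⁺ : RawDuplicial c ℓ
  C⁺ = record
    { rawModule = record
      { Carrierᴹ = C⁺-Carrier
      ; _≈ᴹ_     = λ xs ys → ∀ π → coeff xs π ≈ coeff ys π
      ; _+ᴹ_     = _++_
      ; _*ₗ_     = λ k → map (λ { (a , π) → (k *K a , π) })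
      ; _*ᵣ_     = λ xs k → map (λ { (a , π) → (a *K k , π) }) xs
      ; 0ᴹ       = []
      ; -ᴹ_      = map (λ { (a , π) → (-K a , π) })
      }
    ; _≺_ = bilin _∘_
    ; _≻_ = bilin _•_
    }

module Submission where

-- Every nonempty
--   parking function is uniquely node L R = L • (1 ∘ R), cut at its last
--   fixed point, with L, R shorter (possibly empty) parking functions: this
--   is the binary-tree structure of the free duplicial algebra.
-- Evaluation, Universal: given A and x, send node L R to L ≻ (x ≺ R)
--   recursively; by induction along the trees this turns • into ≻ and ∘
--   into ≺, so its linear extension is a morphism mapping P^𝟙 to x.  Any
--   other such morphism agrees with it on node L R = L • (𝟙 ∘ R), hence on
--   the basis by induction, hence everywhere.

open import Defs
open import Level using (Level)
open import Data.Product using (_×_; _,_)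
open import Algebra.Module.Bundles using (Module)

-- Combinatorics of nondecreasing parking functions as words.
module Words where

  open import Data.Nat using (ℕ; suc; _+_; _∸_; _⊔_; _≤_; _<_; z≤n; s≤s; _≟_)
  open import Data.Nat.Properties
  open import Data.List using (List; []; _∷_; _++_; map; length)
  open import Data.List.Properties using (++-assoc; length-++; length-map; map-++; map-∘; map-cong; map-id)
  open import Data.Maybe using (Maybe; just; nothing; maybe; _<∣>_)
  import Data.Maybe as Maybe
  open import Data.Product using (Σ-syntax; proj₁; proj₂; map₁)
  open import Data.Sum using (_⊎_; inj₁; inj₂)
  open import Data.Unit using (tt)
  open import Data.Empty using (⊥-elim)
  open import Relation.Nullary using (Dec; yes; no)
  open import Relation.Binary.PropositionalEquality
  open ≡-Reasoning

  shift-shift : ∀ a b w → shift a (shift b w) ≡ shift (a + b) w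
  shift-shift a b w = trans (sym (map-∘ w)) (map-cong (λ r → sym (+-assoc a b r)) w)

  shift-++ : ∀ a u v → shift a (u ++ v) ≡ shift a u ++ shift a v
  shift-++ a = map-++ (a +_)

  shift-zero : ∀ w → shift 0 w ≡ w
  shift-zero = map-id

  unshift : ∀ k w → map (_∸ k) (shift k w) ≡ w
  unshift k w = trans (sym (map-∘ w)) (trans (map-cong (m+n∸m≡n k) w) (map-id w))

  maxW-++ : ∀ u v → maxW (u ++ v) ≡ maxW u ⊔ maxW v
  maxW-++ []      v = refl
  maxW-++ (x ∷ u) v = trans (cong (x ⊔_) (maxW-++ u v)) (sym (⊔-assoc x (maxW u) (maxW v)))

  maxW-shift : ∀ k a w → maxW (shift k (a ∷ w)) ≡ k + maxW (a ∷ w)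
  maxW-shift k a []      = trans (⊔-identityʳ (k + a)) (cong (k +_) (sym (⊔-identityʳ a)))
  maxW-shift k a (b ∷ w) =
    trans (cong ((k + a) ⊔_) (maxW-shift k b w)) (sym (+-distribˡ-⊔ k a (maxW (b ∷ w))))

  -- letters of a parking function are bounded by their positions,
  -- hence by the length of the word
  maxW-≤-length : ∀ w → IsNDPF w → maxW w ≤ length w
  maxW-≤-length w ok = ≤-trans (bound 0 w ok) (≤-reflexive (+-identityʳ (length w)))
    where
      bound : ∀ {p} i w → NDPF-from p (suc i) w → maxW w ≤ length w + i
      bound i []      _             = z≤n
      bound i (x ∷ w) (_ , x≤ , ok) =
        ⊔-lub (≤-trans x≤ (s≤s (m≤n+m i (length w))))
              (≤-trans (bound (suc i) w ok) (≤-reflexive (+-suc (length w) i)))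

  maxW-positive : (β : NDPF) → 1 ≤ maxW (word β)
  maxW-positive (ndpf []      _          ne) = ⊥-elim (ne refl)
  maxW-positive (ndpf (b ∷ w) (1≤b , _) _)  = ≤-trans 1≤b (m≤m⊔n b (maxW w))

  assoc•w : ∀ α β γ → (α •w β) •w γ ≡ α •w (β •w γ)
  assoc•w α β γ = begin
    (α ++ shift a β) ++ shift (length (α ++ shift a β)) γ
      ≡⟨ ++-assoc α _ _ ⟩
    α ++ (shift a β ++ shift (length (α ++ shift a β)) γ)
      ≡⟨ cong (λ t → α ++ (shift a β ++ shift t γ)) length-α•β ⟩
    α ++ (shift a β ++ shift (a + length β) γ)
      ≡⟨ cong (λ t → α ++ (shift a β ++ t)) (sym (shift-shift a (length β) γ)) ⟩
    α ++ (shift a β ++ shift a (shift (length β) γ))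
      ≡⟨ cong (α ++_) (sym (shift-++ a β _)) ⟩
    α •w (β •w γ) ∎
    where
      a : ℕ
      a = length α
      length-α•β : length (α ++ shift a β) ≡ a + length β
      length-α•β = trans (length-++ α) (cong (a +_) (length-map (a +_) β))

  -- If the block shift s β carries the maximum of α ++ shift s β, then
  -- a ∘-product on the right acts inside that block.
  ∘-into-shift : ∀ α s β γ → maxW α ≤ suc s → 1 ≤ maxW β →
                 (α ++ shift s β) ∘w γ ≡ α ++ shift s (β ∘w γ)
  ∘-into-shift α s []      γ α≤ ()
  ∘-into-shift α s (b ∷ w) γ α≤ 1≤β = begin
    (α ++ shift s β) ++ shift (maxW (α ++ shift s β) ∸ 1) γ
      ≡⟨ cong (λ t → (α ++ shift s β) ++ shift t γ) max-eq ⟩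
    (α ++ shift s β) ++ shift (s + m) γ
      ≡⟨ ++-assoc α _ _ ⟩
    α ++ (shift s β ++ shift (s + m) γ)
      ≡⟨ cong (λ t → α ++ (shift s β ++ t)) (sym (shift-shift s m γ)) ⟩
    α ++ (shift s β ++ shift s (shift m γ))
      ≡⟨ cong (α ++_) (sym (shift-++ s β _)) ⟩
    α ++ shift s (β ∘w γ) ∎
    where
      β : List ℕ
      β = b ∷ w
      m : ℕ
      m = maxW β ∸ 1
      α≤shifted : maxW α ≤ s + maxW β
      α≤shifted = ≤-trans α≤ (≤-trans (≤-reflexive (+-comm 1 s)) (+-monoʳ-≤ s 1≤β))
      max-eq : maxW (α ++ shift s β) ∸ 1 ≡ s + m
      max-eq = begin
        maxW (α ++ shift s β) ∸ 1        ≡⟨ cong (_∸ 1) (maxW-++ α (shift s β)) ⟩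
        (maxW α ⊔ maxW (shift s β)) ∸ 1  ≡⟨ cong (λ t → (maxW α ⊔ t) ∸ 1) (maxW-shift s b w) ⟩
        (maxW α ⊔ (s + maxW β)) ∸ 1      ≡⟨ cong (_∸ 1) (m≤n⇒m⊔n≡n α≤shifted) ⟩
        (s + maxW β) ∸ 1                 ≡⟨ +-∸-assoc s 1≤β ⟩
        s + m                            ∎

  assoc∘w : ∀ α β γ → 1 ≤ maxW β → (α ∘w β) ∘w γ ≡ α ∘w (β ∘w γ)
  assoc∘w α β γ = ∘-into-shift α (maxW α ∸ 1) β γ (m≤n+m∸n (maxW α) 1)

  assoc•∘w : ∀ α β γ → IsNDPF α → 1 ≤ maxW β → (α •w β) ∘w γ ≡ α •w (β ∘w γ)
  assoc•∘w α β γ ok = ∘-into-shift α (length α) β γ (≤-trans (maxW-≤-length α ok) (n≤1+n _))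

  assoc• : ∀ α β γ → word ((α • β) • γ) ≡ word (α • (β • γ))
  assoc• α β γ = assoc•w (word α) (word β) (word γ)

  assoc∘ : ∀ α β γ → word ((α ∘ β) ∘ γ) ≡ word (α ∘ (β ∘ γ))
  assoc∘ α β γ = assoc∘w (word α) (word β) (word γ) (maxW-positive β)

  assoc•∘ : ∀ α β γ → word ((α • β) ∘ γ) ≡ word (α • (β ∘ γ))
  assoc•∘ α β γ = assoc•∘w (word α) (word β) (word γ) (isNDPF α) (maxW-positive β)

  -- Every nonempty parking
  -- function w is uniquely  node L R = L • (1 ∘ R), with L, R possibly
  -- empty parking functions; |L| + 1 is the last fixed point of w
  -- (a position carrying its own value).

  node : List ℕ → List ℕ → List ℕ
  node L R = L •w (1 ∷ R)

  -- the letter 1 in front: its maximum is never the relevant one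
  1∷-∘w : ∀ R β → (1 ∷ R) ∘w β ≡ 1 ∷ (R ∘w β)
  1∷-∘w R β = cong (λ t → 1 ∷ R ++ shift t β) (∸-distribʳ-⊔ 1 1 (maxW R))

  node-as-products : ∀ L R → node L R ≡ L •w ((1 ∷ []) ∘w R)
  node-as-products L R = cong (λ t → L •w (1 ∷ t)) (sym (shift-zero R))

  node-•w : ∀ α L R → α •w node L R ≡ node (α •w L) R
  node-•w α L R = sym (assoc•w α L (1 ∷ R))

  node-∘w : ∀ L R β → IsNDPF L → node L R ∘w β ≡ node L (R ∘w β)
  node-∘w L R β ok =
    trans (assoc•∘w L (1 ∷ R) β ok (m≤m⊔n 1 (maxW R))) (cong (L •w_) (1∷-∘w R β))

  node-length : ∀ L R → length (node L R) ≡ length L + suc (length R)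
  node-length L R = trans (length-++ L) (cong (λ t → length L + suc t) (length-map _ R))

  node-partˡ-shorter : ∀ L R {w k} → w ≡ node L R → length w ≤ k → length L < k
  node-partˡ-shorter L R refl w≤k = ≤-trans (s≤s (m≤m+n (length L) (length R)))
    (≤-trans (≤-reflexive (sym (trans (node-length L R) (+-suc (length L) (length R))))) w≤k)

  node-partʳ-shorter : ∀ L R {w k} → w ≡ node L R → length w ≤ k → length R < k
  node-partʳ-shorter L R refl w≤k = ≤-trans (s≤s (m≤n+m (length R) (length L)))
    (≤-trans (≤-reflexive (sym (trans (node-length L R) (+-suc (length L) (length R))))) w≤k)

  -- Finding the last fixed point.  lastFixedFrom i w inspects a word whose
  -- first letter sits at position i and returns the parts before and after
  -- its last fixed point, if there is one.

  fixedAt : ∀ {x i : ℕ} → Dec (x ≡ i) → List ℕ → Maybe (List ℕ × List ℕ)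
  fixedAt (yes _) S = just ([] , S)
  fixedAt (no _)  _ = nothing

  lastFixedFrom : ℕ → List ℕ → Maybe (List ℕ × List ℕ)
  lastFixedFrom i []       = nothing
  lastFixedFrom i (x ∷ xs) =
    Maybe.map (map₁ (x ∷_)) (lastFixedFrom (suc i) xs) <∣> fixedAt (x ≟ i) xs

  split : List ℕ → List ℕ × List ℕ
  split w = maybe (λ (L , S) → L , map (_∸ length L) S) ([] , []) (lastFixedFrom 1 w)

  shift-NDPF : ∀ k {p i} w → NDPF-from p i w → NDPF-from (k + p) (k + i) (shift k w)
  shift-NDPF k []       _                   = tt
  shift-NDPF k {i = i} (x ∷ w) (p≤x , x≤i , ok) =
    +-monoʳ-≤ k p≤x , +-monoʳ-≤ k x≤i ,
    subst (λ j → NDPF-from (k + x) j (shift k w)) (+-suc k i) (shift-NDPF k w ok)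

  -- in a tail NDPF-from q j S, placed from position j + 1 on, every letter
  -- lies strictly below its position
  no-fixed-point : ∀ {q j} S → NDPF-from q j S → lastFixedFrom (suc j) S ≡ nothing
  no-fixed-point []      _ = refl
  no-fixed-point {j = j} (x ∷ S) (_ , x≤j , ok) rewrite no-fixed-point S ok with x ≟ suc j
  ... | yes x≡1+j = ⊥-elim (1+n≰n (subst (_≤ j) x≡1+j x≤j))
  ... | no  _     = refl

  lastFixed-at : ∀ i L S j → j ≡ length L + i → lastFixedFrom (suc j) S ≡ nothing →
                 lastFixedFrom i (L ++ j ∷ S) ≡ just (L , S)
  lastFixed-at i []      S j refl none rewrite none with i ≟ i
  ... | yes _  = refl
  ... | no i≢i = ⊥-elim (i≢i refl)
  lastFixed-at i (x ∷ L) S j j≡ none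
    rewrite lastFixed-at (suc i) L S j (trans j≡ (sym (+-suc (length L) i))) none = refl

  split-node : ∀ L R → IsNDPF R → split (node L R) ≡ (L , R)
  split-node L R ok
    rewrite lastFixed-at 1 L (shift (length L) R) (length L + 1) refl
              (no-fixed-point (shift (length L) R) (shift-NDPF (length L) R ok))
    = cong (L ,_) (unshift (length L) R)

  NDPF-prefix : ∀ {p i} u v → NDPF-from p i (u ++ v) → NDPF-from p i u
  NDPF-prefix []      v _              = tt
  NDPF-prefix (x ∷ u) v (p≤x , x≤ , ok) = p≤x , x≤ , NDPF-prefix u v ok

  -- A tail placed from position i + 1 on either has no fixed point (all
  -- its letters lie strictly below their positions) or splits at its last
  -- fixed point j, after which it has none.
  lastFixedPoint : ∀ {p} i w → NDPF-from p (suc i) w →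
    NDPF-from p i w ⊎
    Σ[ u ∈ List ℕ ] Σ[ S ∈ List ℕ ] Σ[ j ∈ ℕ ]
      (j ≡ length u + suc i × w ≡ u ++ j ∷ S × NDPF-from j j S)
  lastFixedPoint i []      _ = inj₁ tt
  lastFixedPoint i (x ∷ w) (p≤x , x≤ , ok) with lastFixedPoint (suc i) w ok
  ... | inj₂ (u , S , j , j≡ , w≡ , S-ok) =
    inj₂ (x ∷ u , S , j , trans j≡ (+-suc (length u) (suc i)) , cong (x ∷_) w≡ , S-ok)
  ... | inj₁ below with x ≟ suc i
  ...   | yes refl = inj₂ ([] , w , suc i , refl , refl , below)
  ...   | no  x≢   = inj₁ (p≤x , ≤-pred (≤∧≢⇒< x≤ x≢) , below)

  -- the tail after the fixed point k + 1 is a shifted parking function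
  unshift-NDPF : ∀ k {q i} S → k ≤ q → NDPF-from q (k + i) S →
    NDPF-from (q ∸ k) i (map (_∸ k) S) × shift k (map (_∸ k) S) ≡ S
  unshift-NDPF k []      _   _ = tt , refl
  unshift-NDPF k {i = i} (x ∷ S) k≤q (q≤x , x≤ , ok) =
    (∸-monoˡ-≤ k q≤x , m≤n+o⇒m∸n≤o x k x≤ , proj₁ rest) , cong₂ _∷_ (m+[n∸m]≡n k≤x) (proj₂ rest)
    where
      k≤x : k ≤ x
      k≤x = ≤-trans k≤q q≤x
      rest : NDPF-from (x ∸ k) (suc i) (map (_∸ k) S) × shift k (map (_∸ k) S) ≡ S
      rest = unshift-NDPF k S k≤x (subst (λ t → NDPF-from x t S) (sym (+-suc k i)) ok)

  node-cover : ∀ x w → IsNDPF (x ∷ w) →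
    Σ[ L ∈ List ℕ ] Σ[ R ∈ List ℕ ] (IsNDPF L × IsNDPF R × x ∷ w ≡ node L R)
  node-cover x w ok with lastFixedPoint 0 (x ∷ w) ok
  ... | inj₁ (1≤x , x≤0 , _) = ⊥-elim (1+n≰n (≤-trans 1≤x x≤0))
  ... | inj₂ (L , S , _ , refl , w≡ , S-ok) =
    L , map (_∸ k) S , NDPF-prefix L _ (subst IsNDPF w≡ ok) ,
    subst (λ t → NDPF-from t 1 (map (_∸ k) S)) (m+n∸m≡n k 1) (proj₁ R-ok) ,
    trans w≡ (cong (λ t → L ++ (k + 1) ∷ t) (sym (proj₂ R-ok)))
    where
      k : ℕ
      k = length L
      R-ok : NDPF-from (k + 1 ∸ k) 1 (map (_∸ k) S) × shift k (map (_∸ k) S) ≡ S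
      R-ok = unshift-NDPF k {k + 1} {1} S (m≤m+n k 1) S-ok

-- Linear maps out of C⁺ into a K-module M, given on the basis.
module LinearExtension {c ℓ : Level} (K : Field c ℓ) {m ℓm : Level}
                       (M : Module (Field.commutativeRing K) m ℓm) where

  open import Data.Nat using (suc; _≤_; z≤n; s≤s) renaming (_≟_ to _≟ℕ_)
  open import Data.Nat.Properties using (≤-refl; ≤-trans; n≤1+n)
  open import Data.List using (List; []; _∷_; _++_; map; length)
  open import Data.List.Properties using (≡-dec)
  open import Data.Product using (proj₁; proj₂)
  open import Data.Empty using (⊥-elim)
  open import Relation.Nullary using (¬_; yes; no)
  open import Relation.Binary.PropositionalEquality using (_≡_; refl; trans; sym)
  open import Algebra.Bundles using (CommutativeMonoid)

  open Field K using (Carrier; 0#; 1#; ring)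
    renaming (_≈_ to _≈K_; _+_ to _+K_; _*_ to _*K_; -_ to -K_)
  private module K = Field K
  open Module M
  open import Algebra.Properties.Ring ring using (-1*x≈-x)
  open import Algebra.Properties.AbelianGroup +ᴹ-abelianGroup using (inverseˡ-unique)
  open import Algebra.Properties.CommutativeSemigroup
    (CommutativeMonoid.commutativeSemigroup +ᴹ-commutativeMonoid) using (x∙yz≈y∙xz; interchange)
  open import Relation.Binary.Reasoning.Setoid ≈ᴹ-setoid

  extend : (NDPF → Carrierᴹ) → C⁺-Carrier K → Carrierᴹ
  extend F []             = 0ᴹ
  extend F ((a , σ) ∷ xs) = a *ₗ F σ +ᴹ extend F xs

  extend-++ : ∀ F xs ys → extend F (xs ++ ys) ≈ᴹ extend F xs +ᴹ extend F ys
  extend-++ F []             ys = ≈ᴹ-sym (+ᴹ-identityˡ _)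
  extend-++ F ((a , σ) ∷ xs) ys =
    ≈ᴹ-trans (+ᴹ-congˡ (extend-++ F xs ys)) (≈ᴹ-sym (+ᴹ-assoc _ _ _))

  extend-pointwise : ∀ F G → (∀ σ → F σ ≈ᴹ G σ) → ∀ xs → extend F xs ≈ᴹ extend G xs
  extend-pointwise F G F≈G []             = ≈ᴹ-refl
  extend-pointwise F G F≈G ((a , σ) ∷ xs) = +ᴹ-cong (*ₗ-congˡ (F≈G σ)) (extend-pointwise F G F≈G xs)

  extend-+ : ∀ F G xs → extend (λ σ → F σ +ᴹ G σ) xs ≈ᴹ extend F xs +ᴹ extend G xs
  extend-+ F G []             = ≈ᴹ-sym (+ᴹ-identityˡ _)
  extend-+ F G ((a , σ) ∷ xs) = begin
    a *ₗ (F σ +ᴹ G σ) +ᴹ extend (λ σ → F σ +ᴹ G σ) xs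
      ≈⟨ +ᴹ-cong (*ₗ-distribˡ a (F σ) (G σ)) (extend-+ F G xs) ⟩
    (a *ₗ F σ +ᴹ a *ₗ G σ) +ᴹ (extend F xs +ᴹ extend G xs)
      ≈⟨ interchange _ _ _ _ ⟩
    (a *ₗ F σ +ᴹ extend F xs) +ᴹ (a *ₗ G σ +ᴹ extend G xs) ∎

  extend-scale : ∀ k F xs → extend (λ σ → k *ₗ F σ) xs ≈ᴹ k *ₗ extend F xs
  extend-scale k F []             = ≈ᴹ-sym (*ₗ-zeroʳ k)
  extend-scale k F ((a , σ) ∷ xs) = begin
    a *ₗ (k *ₗ F σ) +ᴹ extend (λ σ → k *ₗ F σ) xs
      ≈⟨ +ᴹ-cong scalars-commute (extend-scale k F xs) ⟩
    k *ₗ (a *ₗ F σ) +ᴹ k *ₗ extend F xs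
      ≈⟨ *ₗ-distribˡ k _ _ ⟨
    k *ₗ (a *ₗ F σ +ᴹ extend F xs) ∎
    where
      scalars-commute : a *ₗ (k *ₗ F σ) ≈ᴹ k *ₗ (a *ₗ F σ)
      scalars-commute = begin
        a *ₗ (k *ₗ F σ) ≈⟨ *ₗ-assoc a k (F σ) ⟨
        (a *K k) *ₗ F σ ≈⟨ *ₗ-congʳ (K.*-comm a k) ⟩
        (k *K a) *ₗ F σ ≈⟨ *ₗ-assoc k a (F σ) ⟩
        k *ₗ (a *ₗ F σ) ∎

  extend-map : ∀ F G k (h : Carrier × NDPF → Carrier × NDPF) →
    (∀ a σ → proj₁ (h (a , σ)) ≈K k *K a) → (∀ a σ → F (proj₂ (h (a , σ))) ≈ᴹ G σ) →
    ∀ xs → extend F (map h xs) ≈ᴹ k *ₗ extend G xs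
  extend-map F G k h coef basis []             = ≈ᴹ-sym (*ₗ-zeroʳ k)
  extend-map F G k h coef basis ((a , σ) ∷ xs) = begin
    proj₁ (h (a , σ)) *ₗ F (proj₂ (h (a , σ))) +ᴹ extend F (map h xs)
      ≈⟨ +ᴹ-cong (*ₗ-cong (coef a σ) (basis a σ)) (extend-map F G k h coef basis xs) ⟩
    (k *K a) *ₗ G σ +ᴹ k *ₗ extend G xs
      ≈⟨ +ᴹ-congʳ (*ₗ-assoc k a (G σ)) ⟩
    k *ₗ (a *ₗ G σ) +ᴹ k *ₗ extend G xs
      ≈⟨ *ₗ-distribˡ k _ _ ⟨
    k *ₗ (a *ₗ G σ +ᴹ extend G xs) ∎

  -1*ₗ-negates : ∀ v → (-K 1#) *ₗ v ≈ᴹ -ᴹ v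
  -1*ₗ-negates v = inverseˡ-unique _ _ (begin
    (-K 1#) *ₗ v +ᴹ v           ≈⟨ +ᴹ-congˡ (*ₗ-identityˡ v) ⟨
    (-K 1#) *ₗ v +ᴹ 1# *ₗ v     ≈⟨ *ₗ-distribʳ v (-K 1#) 1# ⟨
    ((-K 1#) +K 1#) *ₗ v        ≈⟨ *ₗ-congʳ (K.-‿inverseˡ 1#) ⟩
    0# *ₗ v                     ≈⟨ *ₗ-zeroˡ v ⟩
    0ᴹ                          ∎)

  extend-negate : ∀ F (h : Carrier × NDPF → Carrier × NDPF) →
    (∀ a σ → proj₁ (h (a , σ)) ≈K -K a) → (∀ a σ → F (proj₂ (h (a , σ))) ≈ᴹ F σ) →
    ∀ xs → extend F (map h xs) ≈ᴹ -ᴹ extend F xs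
  extend-negate F h coef basis xs = ≈ᴹ-trans
    (extend-map F F (-K 1#) h (λ a σ → K.trans (coef a σ) (K.sym (-1*x≈-x a))) basis xs)
    (-1*ₗ-negates _)

  extend-bilin : ∀ F op xs ys →
    extend F (bilin K op xs ys) ≈ᴹ extend (λ α → extend (λ β → F (op α β)) ys) xs
  extend-bilin F op []             ys = ≈ᴹ-refl
  extend-bilin F op ((a , α) ∷ xs) ys = begin
    extend F (map _ ys ++ bilin K op xs ys)
      ≈⟨ extend-++ F (map _ ys) _ ⟩
    extend F (map _ ys) +ᴹ extend F (bilin K op xs ys)
      ≈⟨ +ᴹ-cong (extend-map F (λ β → F (op α β)) a _ (λ b β → K.refl) (λ b β → ≈ᴹ-refl) ys)
                 (extend-bilin F op xs ys) ⟩
    a *ₗ extend (λ β → F (op α β)) ys +ᴹ extend (λ α → extend (λ β → F (op α β)) ys) xs ∎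

  -- extend F is well defined on C⁺ (it only depends on the coefficients)
  -- as soon as F only depends on the underlying words.

  RespectsWords : (NDPF → Carrierᴹ) → Set ℓm
  RespectsWords F = ∀ σ τ → word σ ≡ word τ → F σ ≈ᴹ F τ

  remove : NDPF → C⁺-Carrier K → C⁺-Carrier K
  remove σ []             = []
  remove σ ((a , τ) ∷ xs) with ≡-dec _≟ℕ_ (word τ) (word σ)
  ... | yes _ = remove σ xs
  ... | no  _ = (a , τ) ∷ remove σ xs

  extend-remove : ∀ F → RespectsWords F → ∀ σ xs →
    extend F xs ≈ᴹ coeff K xs σ *ₗ F σ +ᴹ extend F (remove σ xs)
  extend-remove F resp σ []             = ≈ᴹ-sym (≈ᴹ-trans (+ᴹ-identityʳ _) (*ₗ-zeroˡ _))
  extend-remove F resp σ ((a , τ) ∷ xs) with ≡-dec _≟ℕ_ (word τ) (word σ)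
  ... | yes τ≡σ = begin
    a *ₗ F τ +ᴹ extend F xs
      ≈⟨ +ᴹ-cong (*ₗ-congˡ (resp τ σ τ≡σ)) (extend-remove F resp σ xs) ⟩
    a *ₗ F σ +ᴹ (coeff K xs σ *ₗ F σ +ᴹ extend F (remove σ xs))
      ≈⟨ +ᴹ-assoc _ _ _ ⟨
    (a *ₗ F σ +ᴹ coeff K xs σ *ₗ F σ) +ᴹ extend F (remove σ xs)
      ≈⟨ +ᴹ-congʳ (*ₗ-distribʳ (F σ) a (coeff K xs σ)) ⟨
    (a +K coeff K xs σ) *ₗ F σ +ᴹ extend F (remove σ xs) ∎
  ... | no _ = begin
    a *ₗ F τ +ᴹ extend F xs
      ≈⟨ +ᴹ-congˡ (extend-remove F resp σ xs) ⟩
    a *ₗ F τ +ᴹ (coeff K xs σ *ₗ F σ +ᴹ extend F (remove σ xs))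
      ≈⟨ x∙yz≈y∙xz _ _ _ ⟩
    coeff K xs σ *ₗ F σ +ᴹ (a *ₗ F τ +ᴹ extend F (remove σ xs)) ∎

  coeff-remove-same : ∀ σ π xs → word π ≡ word σ → coeff K (remove σ xs) π ≈K 0#
  coeff-remove-same σ π []             _   = K.refl
  coeff-remove-same σ π ((a , τ) ∷ xs) π≡σ with ≡-dec _≟ℕ_ (word τ) (word σ)
  ... | yes _   = coeff-remove-same σ π xs π≡σ
  ... | no  τ≢σ with ≡-dec _≟ℕ_ (word τ) (word π)
  ...   | yes τ≡π = ⊥-elim (τ≢σ (trans τ≡π π≡σ))
  ...   | no  _   = coeff-remove-same σ π xs π≡σ

  coeff-remove-other : ∀ σ π xs → ¬ word π ≡ word σ → coeff K (remove σ xs) π ≈K coeff K xs π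
  coeff-remove-other σ π []             _   = K.refl
  coeff-remove-other σ π ((a , τ) ∷ xs) π≢σ with ≡-dec _≟ℕ_ (word τ) (word σ)
  ... | yes τ≡σ with ≡-dec _≟ℕ_ (word τ) (word π)
  ...   | yes τ≡π = ⊥-elim (π≢σ (trans (sym τ≡π) τ≡σ))
  ...   | no  _   = coeff-remove-other σ π xs π≢σ
  coeff-remove-other σ π ((a , τ) ∷ xs) π≢σ | no _ with ≡-dec _≟ℕ_ (word τ) (word π)
  ...   | yes _ = K.+-congˡ (coeff-remove-other σ π xs π≢σ)
  ...   | no  _ = coeff-remove-other σ π xs π≢σ

  coeff-remove : ∀ σ xs ys → (∀ π → coeff K xs π ≈K coeff K ys π) →
    ∀ π → coeff K (remove σ xs) π ≈K coeff K (remove σ ys) π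
  coeff-remove σ xs ys xs≈ys π with ≡-dec _≟ℕ_ (word π) (word σ)
  ... | yes π≡σ = K.trans (coeff-remove-same σ π xs π≡σ) (K.sym (coeff-remove-same σ π ys π≡σ))
  ... | no  π≢σ = K.trans (coeff-remove-other σ π xs π≢σ)
                    (K.trans (xs≈ys π) (K.sym (coeff-remove-other σ π ys π≢σ)))

  remove-shorter : ∀ σ xs → length (remove σ xs) ≤ length xs
  remove-shorter σ []             = z≤n
  remove-shorter σ ((a , τ) ∷ xs) with ≡-dec _≟ℕ_ (word τ) (word σ)
  ... | yes _ = ≤-trans (remove-shorter σ xs) (n≤1+n _)
  ... | no  _ = s≤s (remove-shorter σ xs)

  remove-shortens : ∀ a σ xs → length (remove σ ((a , σ) ∷ xs)) ≤ length xs
  remove-shortens a σ xs with ≡-dec _≟ℕ_ (word σ) (word σ)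
  ... | yes _   = remove-shorter σ xs
  ... | no  σ≢σ = ⊥-elim (σ≢σ refl)

  -- both proofs peel off all terms on one basis element at a time
  -- (induction on the length n of the sum)
  extend-zero : ∀ F → RespectsWords F → ∀ n ys → length ys ≤ n →
    (∀ π → coeff K ys π ≈K 0#) → extend F ys ≈ᴹ 0ᴹ
  extend-zero F resp n       []             _         _      = ≈ᴹ-refl
  extend-zero F resp (suc n) ((a , σ) ∷ ys) (s≤s len) zeroes = begin
    extend F ys₀                                    ≈⟨ extend-remove F resp σ ys₀ ⟩
    coeff K ys₀ σ *ₗ F σ +ᴹ extend F (remove σ ys₀)
      ≈⟨ +ᴹ-cong (≈ᴹ-trans (*ₗ-congʳ (zeroes σ)) (*ₗ-zeroˡ _))
                 (extend-zero F resp n (remove σ ys₀) (≤-trans (remove-shortens a σ ys) len)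
                    (coeff-remove σ ys₀ [] zeroes)) ⟩
    0ᴹ +ᴹ 0ᴹ                                        ≈⟨ +ᴹ-identityˡ _ ⟩
    0ᴹ                                              ∎
    where
      ys₀ : C⁺-Carrier K
      ys₀ = (a , σ) ∷ ys

  extend-respects′ : ∀ F → RespectsWords F → ∀ n xs ys → length xs ≤ n →
    (∀ π → coeff K xs π ≈K coeff K ys π) → extend F xs ≈ᴹ extend F ys
  extend-respects′ F resp n       []             ys _         xs≈ys =
    ≈ᴹ-sym (extend-zero F resp (length ys) ys ≤-refl (λ π → K.sym (xs≈ys π)))
  extend-respects′ F resp (suc n) ((a , σ) ∷ xs) ys (s≤s len) xs≈ys = begin
    extend F xs₀                                     ≈⟨ extend-remove F resp σ xs₀ ⟩
    coeff K xs₀ σ *ₗ F σ +ᴹ extend F (remove σ xs₀)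
      ≈⟨ +ᴹ-cong (*ₗ-congʳ (xs≈ys σ))
           (extend-respects′ F resp n (remove σ xs₀) (remove σ ys)
              (≤-trans (remove-shortens a σ xs) len) (coeff-remove σ xs₀ ys xs≈ys)) ⟩
    coeff K ys σ *ₗ F σ +ᴹ extend F (remove σ ys)    ≈⟨ extend-remove F resp σ ys ⟨
    extend F ys                                      ∎
    where
      xs₀ : C⁺-Carrier K
      xs₀ = (a , σ) ∷ xs

  extend-respects : ∀ F → RespectsWords F → ∀ xs ys →
    (∀ π → coeff K xs π ≈K coeff K ys π) → extend F xs ≈ᴹ extend F ys
  extend-respects F resp xs ys = extend-respects′ F resp (length xs) xs ys ≤-refl

  module Multiplicative
    (_⊙_ : Carrierᴹ → Carrierᴹ → Carrierᴹ)
    (⊙-cong     : ∀ {u u′ v v′} → u ≈ᴹ u′ → v ≈ᴹ v′ → (u ⊙ v) ≈ᴹ (u′ ⊙ v′))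
    (⊙-distribˡ : ∀ u v w → (u ⊙ (v +ᴹ w)) ≈ᴹ ((u ⊙ v) +ᴹ (u ⊙ w)))
    (⊙-distribʳ : ∀ u v w → ((v +ᴹ w) ⊙ u) ≈ᴹ ((v ⊙ u) +ᴹ (w ⊙ u)))
    (⊙-scaleˡ   : ∀ k u v → ((k *ₗ u) ⊙ v) ≈ᴹ (k *ₗ (u ⊙ v)))
    (⊙-scaleʳ   : ∀ k u v → (u ⊙ (k *ₗ v)) ≈ᴹ (k *ₗ (u ⊙ v)))
    where

    ⊙-zeroʳ : ∀ u → (u ⊙ 0ᴹ) ≈ᴹ 0ᴹ
    ⊙-zeroʳ u = begin
      u ⊙ 0ᴹ          ≈⟨ ⊙-cong ≈ᴹ-refl (*ₗ-zeroˡ 0ᴹ) ⟨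
      u ⊙ (0# *ₗ 0ᴹ)  ≈⟨ ⊙-scaleʳ 0# u 0ᴹ ⟩
      0# *ₗ (u ⊙ 0ᴹ)  ≈⟨ *ₗ-zeroˡ _ ⟩
      0ᴹ              ∎

    ⊙-zeroˡ : ∀ u → (0ᴹ ⊙ u) ≈ᴹ 0ᴹ
    ⊙-zeroˡ u = begin
      0ᴹ ⊙ u          ≈⟨ ⊙-cong (*ₗ-zeroˡ 0ᴹ) ≈ᴹ-refl ⟨
      (0# *ₗ 0ᴹ) ⊙ u  ≈⟨ ⊙-scaleˡ 0# 0ᴹ u ⟩
      0# *ₗ (0ᴹ ⊙ u)  ≈⟨ *ₗ-zeroˡ _ ⟩
      0ᴹ              ∎

    extend-⊙ʳ : ∀ u G ys → extend (λ β → u ⊙ G β) ys ≈ᴹ (u ⊙ extend G ys)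
    extend-⊙ʳ u G []             = ≈ᴹ-sym (⊙-zeroʳ u)
    extend-⊙ʳ u G ((b , β) ∷ ys) = begin
      b *ₗ (u ⊙ G β) +ᴹ extend (λ β → u ⊙ G β) ys
        ≈⟨ +ᴹ-cong (≈ᴹ-sym (⊙-scaleʳ b u (G β))) (extend-⊙ʳ u G ys) ⟩
      (u ⊙ (b *ₗ G β)) +ᴹ (u ⊙ extend G ys)  ≈⟨ ⊙-distribˡ u _ _ ⟨
      u ⊙ (b *ₗ G β +ᴹ extend G ys)          ∎

    extend-⊙ˡ : ∀ v G xs → extend (λ α → G α ⊙ v) xs ≈ᴹ (extend G xs ⊙ v)
    extend-⊙ˡ v G []             = ≈ᴹ-sym (⊙-zeroˡ v)
    extend-⊙ˡ v G ((a , α) ∷ xs) = begin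
      a *ₗ (G α ⊙ v) +ᴹ extend (λ α → G α ⊙ v) xs
        ≈⟨ +ᴹ-cong (≈ᴹ-sym (⊙-scaleˡ a (G α) v)) (extend-⊙ˡ v G xs) ⟩
      ((a *ₗ G α) ⊙ v) +ᴹ (extend G xs ⊙ v)  ≈⟨ ⊙-distribʳ v _ _ ⟨
      (a *ₗ G α +ᴹ extend G xs) ⊙ v          ∎

    extend-multiplicative : ∀ F op → (∀ α β → F (op α β) ≈ᴹ (F α ⊙ F β)) →
      ∀ xs ys → extend F (bilin K op xs ys) ≈ᴹ (extend F xs ⊙ extend F ys)
    extend-multiplicative F op F-mult xs ys = begin
      extend F (bilin K op xs ys)
        ≈⟨ extend-bilin F op xs ys ⟩
      extend (λ α → extend (λ β → F (op α β)) ys) xs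
        ≈⟨ extend-pointwise _ _ (λ α → extend-pointwise _ _ (F-mult α) ys) xs ⟩
      extend (λ α → extend (λ β → F α ⊙ F β) ys) xs
        ≈⟨ extend-pointwise _ _ (λ α → extend-⊙ʳ (F α) F ys) xs ⟩
      extend (λ α → F α ⊙ extend F ys) xs
        ≈⟨ extend-⊙ˡ (extend F ys) F xs ⟩
      extend F xs ⊙ extend F ys ∎

module CPlusStructure {c ℓ : Level} (K : Field c ℓ) where

  open import Data.Nat using () renaming (_≟_ to _≟ℕ_)
  open import Data.List using ([]; _∷_; _++_)
  open import Data.List.Properties using (≡-dec; ++-assoc; ++-identityʳ)
  open import Relation.Nullary using (yes; no)
  open import Relation.Binary.PropositionalEquality using (_≡_; refl; sym; trans; cong; cong₂)
  open import Data.Empty using (⊥-elim)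
  open import Algebra.Module.Construct.TensorUnit using (⟨module⟩)
  open import Algebra.Structures using (IsCommutativeMonoid)
  open import Algebra.Module.Structures using (IsPreleftSemimodule; IsPrerightSemimodule; IsModule)

  open Field K using (Carrier; 0#; 1#; _≈_; _+_; _*_; -_; commutativeRing; semiring)
  private module K = Field K
  open RawDuplicial (C⁺ K) using (_≈ᴹ_; _+ᴹ_; 0ᴹ; -ᴹ_; _*ₗ_; _*ᵣ_)
  open import Relation.Binary.Reasoning.Setoid K.setoid

  -- K as a module over itself: coefficients are values of linear extensions
  open LinearExtension K (⟨module⟩ {R = commutativeRing})
    using (extend; extend-++; extend-pointwise; extend-+; extend-scale; extend-map;
           extend-negate; extend-bilin; RespectsWords; extend-respects)

  δ : NDPF → NDPF → Carrier
  δ π σ = coeff K (P K σ) π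

  δ-respects : ∀ π → RespectsWords (δ π)
  δ-respects π σ τ σ≡τ with ≡-dec _≟ℕ_ (word σ) (word π) | ≡-dec _≟ℕ_ (word τ) (word π)
  ... | yes _   | yes _   = K.refl
  ... | yes σ≡π | no  τ≢π = ⊥-elim (τ≢π (trans (sym σ≡τ) σ≡π))
  ... | no  σ≢π | yes τ≡π = ⊥-elim (σ≢π (trans σ≡τ τ≡π))
  ... | no  _   | no  _   = K.refl

  coeff-as-extend : ∀ π xs → coeff K xs π ≈ extend (δ π) xs
  coeff-as-extend π []             = K.refl
  coeff-as-extend π ((a , σ) ∷ xs) with ≡-dec _≟ℕ_ (word σ) (word π)
  ... | yes _ = K.+-cong (K.sym (K.trans (K.*-congˡ (K.+-identityʳ 1#)) (K.*-identityʳ a)))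
                         (coeff-as-extend π xs)
  ... | no  _ = K.sym (K.trans (K.+-congʳ (K.zeroʳ a)) (K.trans (K.+-identityˡ _)
                  (K.sym (coeff-as-extend π xs))))

  coeff-++ : ∀ xs ys π → coeff K (xs ++ ys) π ≈ coeff K xs π + coeff K ys π
  coeff-++ xs ys π = begin
    coeff K (xs ++ ys) π                ≈⟨ coeff-as-extend π (xs ++ ys) ⟩
    extend (δ π) (xs ++ ys)             ≈⟨ extend-++ (δ π) xs ys ⟩
    extend (δ π) xs + extend (δ π) ys   ≈⟨ K.+-cong (coeff-as-extend π xs) (coeff-as-extend π ys) ⟨
    coeff K xs π + coeff K ys π         ∎

  coeff-*ₗ : ∀ k xs π → coeff K (k *ₗ xs) π ≈ k * coeff K xs π
  coeff-*ₗ k xs π = begin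
    coeff K (k *ₗ xs) π    ≈⟨ coeff-as-extend π (k *ₗ xs) ⟩
    extend (δ π) (k *ₗ xs) ≈⟨ extend-map (δ π) (δ π) k _ (λ _ _ → K.refl) (λ _ _ → K.refl) xs ⟩
    k * extend (δ π) xs    ≈⟨ K.*-congˡ (coeff-as-extend π xs) ⟨
    k * coeff K xs π       ∎

  coeff-*ᵣ : ∀ xs k π → coeff K (xs *ᵣ k) π ≈ k * coeff K xs π
  coeff-*ᵣ xs k π = begin
    coeff K (xs *ᵣ k) π    ≈⟨ coeff-as-extend π (xs *ᵣ k) ⟩
    extend (δ π) (xs *ᵣ k) ≈⟨ extend-map (δ π) (δ π) k _ (λ a _ → K.*-comm a k) (λ _ _ → K.refl) xs ⟩
    k * extend (δ π) xs    ≈⟨ K.*-congˡ (coeff-as-extend π xs) ⟨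
    k * coeff K xs π       ∎

  coeff-negate : ∀ xs π → coeff K (-ᴹ xs) π ≈ - coeff K xs π
  coeff-negate xs π = begin
    coeff K (-ᴹ xs) π      ≈⟨ coeff-as-extend π (-ᴹ xs) ⟩
    extend (δ π) (-ᴹ xs)   ≈⟨ extend-negate (δ π) _ (λ _ _ → K.refl) (λ _ _ → K.refl) xs ⟩
    - extend (δ π) xs      ≈⟨ K.-‿cong (coeff-as-extend π xs) ⟨
    - coeff K xs π         ∎

  coefficientwise : ∀ xs ys {l r : NDPF → Carrier} → (∀ π → coeff K xs π ≈ l π) →
    (∀ π → l π ≈ r π) → (∀ π → coeff K ys π ≈ r π) → xs ≈ᴹ ys
  coefficientwise xs ys lhs l≈r rhs π = K.trans (lhs π) (K.trans (l≈r π) (K.sym (rhs π)))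

  coeff-+-*ₗ : ∀ a xs b ys π → coeff K ((a *ₗ xs) +ᴹ (b *ₗ ys)) π ≈ a * coeff K xs π + b * coeff K ys π
  coeff-+-*ₗ a xs b ys π =
    K.trans (coeff-++ (a *ₗ xs) (b *ₗ ys) π) (K.+-cong (coeff-*ₗ a xs π) (coeff-*ₗ b ys π))

  coeff-+-*ᵣ : ∀ xs a ys b π → coeff K ((xs *ᵣ a) +ᴹ (ys *ᵣ b)) π ≈ a * coeff K xs π + b * coeff K ys π
  coeff-+-*ᵣ xs a ys b π =
    K.trans (coeff-++ (xs *ᵣ a) (ys *ᵣ b) π) (K.+-cong (coeff-*ᵣ xs a π) (coeff-*ᵣ ys b π))

  -- C⁺ is a K-vector space: every law holds coefficientwise because it
  -- holds in K.

  +ᴹ-isCommutativeMonoid : IsCommutativeMonoid _≈ᴹ_ _+ᴹ_ 0ᴹ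
  +ᴹ-isCommutativeMonoid = record
    { isMonoid = record
      { isSemigroup = record
        { isMagma = record
          { isEquivalence = record
            { refl  = λ π → K.refl
            ; sym   = λ xs≈ys π → K.sym (xs≈ys π)
            ; trans = λ xs≈ys ys≈zs π → K.trans (xs≈ys π) (ys≈zs π) }
          ; ∙-cong = λ {xs} {xs′} {ys} {ys′} xs≈ ys≈ →
              coefficientwise (xs ++ ys) (xs′ ++ ys′)
                (coeff-++ xs ys) (λ π → K.+-cong (xs≈ π) (ys≈ π)) (coeff-++ xs′ ys′) }
        ; assoc = λ xs ys zs π → K.reflexive (cong (λ t → coeff K t π) (++-assoc xs ys zs)) }
      ; identity = (λ xs π → K.refl)
                 , (λ xs π → K.reflexive (cong (λ t → coeff K t π) (++-identityʳ xs))) }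
    ; comm = λ xs ys →
        coefficientwise (xs ++ ys) (ys ++ xs) (coeff-++ xs ys) (λ π → K.+-comm _ _) (coeff-++ ys xs)
    }

  isPreleftSemimodule : IsPreleftSemimodule semiring _≈ᴹ_ _+ᴹ_ 0ᴹ _*ₗ_
  isPreleftSemimodule = record
    { *ₗ-cong = λ {k} {k′} {xs} {xs′} k≈ xs≈ →
        coefficientwise (k *ₗ xs) (k′ *ₗ xs′)
          (coeff-*ₗ k xs) (λ π → K.*-cong k≈ (xs≈ π)) (coeff-*ₗ k′ xs′)
    ; *ₗ-zeroˡ = λ xs →
        coefficientwise (0# *ₗ xs) [] (coeff-*ₗ 0# xs) (λ π → K.zeroˡ _) (λ π → K.refl)
    ; *ₗ-distribʳ = λ xs a b →
        coefficientwise ((a + b) *ₗ xs) ((a *ₗ xs) +ᴹ (b *ₗ xs))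
          (coeff-*ₗ (a + b) xs) (λ π → K.distribʳ _ a b) (coeff-+-*ₗ a xs b xs)
    ; *ₗ-identityˡ = λ xs →
        coefficientwise (1# *ₗ xs) xs (coeff-*ₗ 1# xs) (λ π → K.*-identityˡ _) (λ π → K.refl)
    ; *ₗ-assoc = λ a b xs →
        coefficientwise ((a * b) *ₗ xs) (a *ₗ (b *ₗ xs))
          (coeff-*ₗ (a * b) xs) (λ π → K.*-assoc a b _)
          (λ π → K.trans (coeff-*ₗ a (b *ₗ xs) π) (K.*-congˡ (coeff-*ₗ b xs π)))
    ; *ₗ-zeroʳ = λ k π → K.refl
    ; *ₗ-distribˡ = λ k xs ys →
        coefficientwise (k *ₗ (xs +ᴹ ys)) ((k *ₗ xs) +ᴹ (k *ₗ ys))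
          (λ π → K.trans (coeff-*ₗ k (xs ++ ys) π) (K.*-congˡ (coeff-++ xs ys π)))
          (λ π → K.distribˡ k _ _) (coeff-+-*ₗ k xs k ys)
    }

  isPrerightSemimodule : IsPrerightSemimodule semiring _≈ᴹ_ _+ᴹ_ 0ᴹ _*ᵣ_
  isPrerightSemimodule = record
    { *ᵣ-cong = λ {xs} {xs′} {k} {k′} xs≈ k≈ →
        coefficientwise (xs *ᵣ k) (xs′ *ᵣ k′)
          (coeff-*ᵣ xs k) (λ π → K.*-cong k≈ (xs≈ π)) (coeff-*ᵣ xs′ k′)
    ; *ᵣ-zeroʳ = λ xs →
        coefficientwise (xs *ᵣ 0#) [] (coeff-*ᵣ xs 0#) (λ π → K.zeroˡ _) (λ π → K.refl)
    ; *ᵣ-distribˡ = λ xs a b →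
        coefficientwise (xs *ᵣ (a + b)) ((xs *ᵣ a) +ᴹ (xs *ᵣ b))
          (coeff-*ᵣ xs (a + b)) (λ π → K.distribʳ _ a b) (coeff-+-*ᵣ xs a xs b)
    ; *ᵣ-identityʳ = λ xs →
        coefficientwise (xs *ᵣ 1#) xs (coeff-*ᵣ xs 1#) (λ π → K.*-identityˡ _) (λ π → K.refl)
    ; *ᵣ-assoc = λ xs a b →
        coefficientwise ((xs *ᵣ a) *ᵣ b) (xs *ᵣ (a * b))
          (λ π → K.trans (coeff-*ᵣ (xs *ᵣ a) b π) (K.*-congˡ (coeff-*ᵣ xs a π)))
          (λ π → K.trans (K.sym (K.*-assoc b a _)) (K.*-congʳ (K.*-comm b a)))
          (coeff-*ᵣ xs (a * b))
    ; *ᵣ-zeroˡ = λ k π → K.refl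
    ; *ᵣ-distribʳ = λ k xs ys →
        coefficientwise ((xs +ᴹ ys) *ᵣ k) ((xs *ᵣ k) +ᴹ (ys *ᵣ k))
          (λ π → K.trans (coeff-*ᵣ (xs ++ ys) k π) (K.*-congˡ (coeff-++ xs ys π)))
          (λ π → K.distribˡ k _ _) (coeff-+-*ᵣ xs k ys k)
    }

  isModule-C⁺ : IsModule commutativeRing _≈ᴹ_ _+ᴹ_ 0ᴹ -ᴹ_ _*ₗ_ _*ᵣ_
  isModule-C⁺ = record
    { isBimodule = record
      { isBisemimodule = record
        { +ᴹ-isCommutativeMonoid = +ᴹ-isCommutativeMonoid
        ; isPreleftSemimodule    = isPreleftSemimodule
        ; isPrerightSemimodule   = isPrerightSemimodule
        ; *ₗ-*ᵣ-assoc = λ a xs b →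
            coefficientwise ((a *ₗ xs) *ᵣ b) (a *ₗ (xs *ᵣ b))
              (λ π → K.trans (coeff-*ᵣ (a *ₗ xs) b π) (K.*-congˡ (coeff-*ₗ a xs π)))
              (λ π → K.trans (K.sym (K.*-assoc b a _))
                       (K.trans (K.*-congʳ (K.*-comm b a)) (K.*-assoc a b _)))
              (λ π → K.trans (coeff-*ₗ a (xs *ᵣ b) π) (K.*-congˡ (coeff-*ᵣ xs b π)))
        }
      ; -ᴹ‿cong = λ {xs} {ys} xs≈ys →
          coefficientwise (-ᴹ xs) (-ᴹ ys) (coeff-negate xs) (λ π → K.-‿cong (xs≈ys π)) (coeff-negate ys)
      ; -ᴹ‿inverse =
          (λ xs → coefficientwise ((-ᴹ xs) +ᴹ xs) []
                    (λ π → K.trans (coeff-++ (-ᴹ xs) xs π) (K.+-congʳ (coeff-negate xs π)))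
                    (λ π → K.-‿inverseˡ _) (λ π → K.refl))
        , (λ xs → coefficientwise (xs +ᴹ (-ᴹ xs)) []
                    (λ π → K.trans (coeff-++ xs (-ᴹ xs) π) (K.+-congˡ (coeff-negate xs π)))
                    (λ π → K.-‿inverseʳ _) (λ π → K.refl))
      }
    ; *ₗ-*ᵣ-coincident = λ k xs →
        coefficientwise (k *ₗ xs) (xs *ᵣ k) (coeff-*ₗ k xs) (λ π → K.refl) (coeff-*ᵣ xs k)
    }

  productCoeff : (NDPF → NDPF → NDPF) → NDPF → C⁺-Carrier K → C⁺-Carrier K → Carrier
  productCoeff op π xs ys = extend (λ α → extend (λ β → δ π (op α β)) ys) xs

  coeff-bilin : ∀ op xs ys π → coeff K (bilin K op xs ys) π ≈ productCoeff op π xs ys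
  coeff-bilin op xs ys π = K.trans (coeff-as-extend π (bilin K op xs ys)) (extend-bilin (δ π) op xs ys)

  RespectsWords₂ : (NDPF → NDPF → NDPF) → Set
  RespectsWords₂ op = ∀ {α α′ β β′} → word α ≡ word α′ → word β ≡ word β′ →
                      word (op α β) ≡ word (op α′ β′)

  module Bilinear (op : NDPF → NDPF → NDPF) (resp : RespectsWords₂ op) where

    B : C⁺-Carrier K → C⁺-Carrier K → C⁺-Carrier K
    B = bilin K op

    cong-B : ∀ {xs xs′ ys ys′} → xs ≈ᴹ xs′ → ys ≈ᴹ ys′ → B xs ys ≈ᴹ B xs′ ys′
    cong-B {xs} {xs′} {ys} {ys′} xs≈ ys≈ =
      coefficientwise (B xs ys) (B xs′ ys′) (coeff-bilin op xs ys) same-double-sum (coeff-bilin op xs′ ys′)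
      where
        same-double-sum : ∀ π → productCoeff op π xs ys ≈ productCoeff op π xs′ ys′
        same-double-sum π = begin
          productCoeff op π xs ys
            ≈⟨ extend-pointwise _ _ (λ α → extend-respects (λ β → δ π (op α β))
                 (λ β β′ e → δ-respects π _ _ (resp refl e)) ys ys′ ys≈) xs ⟩
          productCoeff op π xs ys′
            ≈⟨ extend-respects (λ α → extend (λ β → δ π (op α β)) ys′)
                 (λ α α′ e → extend-pointwise _ _ (λ β → δ-respects π _ _ (resp e refl)) ys′)
                 xs xs′ xs≈ ⟩
          productCoeff op π xs′ ys′ ∎

    distribˡ-B : ∀ xs ys zs → B xs (ys ++ zs) ≈ᴹ (B xs ys ++ B xs zs)
    distribˡ-B xs ys zs = coefficientwise (B xs (ys ++ zs)) (B xs ys ++ B xs zs)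
      (coeff-bilin op xs (ys ++ zs))
      (λ π → K.trans (extend-pointwise _ _ (λ α → extend-++ (λ β → δ π (op α β)) ys zs) xs)
                     (extend-+ _ _ xs))
      (λ π → K.trans (coeff-++ (B xs ys) (B xs zs) π)
                     (K.+-cong (coeff-bilin op xs ys π) (coeff-bilin op xs zs π)))

    distribʳ-B : ∀ xs ys zs → B (ys ++ zs) xs ≈ᴹ (B ys xs ++ B zs xs)
    distribʳ-B xs ys zs = coefficientwise (B (ys ++ zs) xs) (B ys xs ++ B zs xs)
      (coeff-bilin op (ys ++ zs) xs)
      (λ π → extend-++ _ ys zs)
      (λ π → K.trans (coeff-++ (B ys xs) (B zs xs) π)
                     (K.+-cong (coeff-bilin op ys xs π) (coeff-bilin op zs xs π)))

    scaleˡ-B : ∀ k xs ys → B (k *ₗ xs) ys ≈ᴹ (k *ₗ B xs ys)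
    scaleˡ-B k xs ys = coefficientwise (B (k *ₗ xs) ys) (k *ₗ B xs ys)
      (coeff-bilin op (k *ₗ xs) ys)
      (λ π → extend-map _ _ k _ (λ _ _ → K.refl) (λ _ _ → K.refl) xs)
      (λ π → K.trans (coeff-*ₗ k (B xs ys) π) (K.*-congˡ (coeff-bilin op xs ys π)))

    scaleʳ-B : ∀ k xs ys → B xs (k *ₗ ys) ≈ᴹ (k *ₗ B xs ys)
    scaleʳ-B k xs ys = coefficientwise (B xs (k *ₗ ys)) (k *ₗ B xs ys)
      (coeff-bilin op xs (k *ₗ ys))
      (λ π → K.trans (extend-pointwise _ _
                        (λ α → extend-map _ _ k _ (λ _ _ → K.refl) (λ _ _ → K.refl) ys) xs)
                     (extend-scale k _ xs))
      (λ π → K.trans (coeff-*ₗ k (B xs ys) π) (K.*-congˡ (coeff-bilin op xs ys π)))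

  bilin-assoc : ∀ op₁ op₂ op₃ op₄ → (∀ α β γ → word (op₁ (op₂ α β) γ) ≡ word (op₃ α (op₄ β γ))) →
    ∀ xs ys zs → bilin K op₁ (bilin K op₂ xs ys) zs ≈ᴹ bilin K op₃ xs (bilin K op₄ ys zs)
  bilin-assoc op₁ op₂ op₃ op₄ words-equal xs ys zs =
    coefficientwise (bilin K op₁ (bilin K op₂ xs ys) zs) (bilin K op₃ xs (bilin K op₄ ys zs))
      left-triple-sum (λ π → K.refl) right-triple-sum
    where
      triple : NDPF → Carrier
      triple π = extend (λ α → extend (λ β → extend (λ γ → δ π (op₃ α (op₄ β γ))) zs) ys) xs

      left-triple-sum : ∀ π → coeff K (bilin K op₁ (bilin K op₂ xs ys) zs) π ≈ triple π
      left-triple-sum π = begin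
        coeff K (bilin K op₁ (bilin K op₂ xs ys) zs) π
          ≈⟨ coeff-bilin op₁ (bilin K op₂ xs ys) zs π ⟩
        extend (λ w → extend (λ γ → δ π (op₁ w γ)) zs) (bilin K op₂ xs ys)
          ≈⟨ extend-bilin (λ w → extend (λ γ → δ π (op₁ w γ)) zs) op₂ xs ys ⟩
        extend (λ α → extend (λ β → extend (λ γ → δ π (op₁ (op₂ α β) γ)) zs) ys) xs
          ≈⟨ extend-pointwise _ _ (λ α → extend-pointwise _ _ (λ β → extend-pointwise _ _
               (λ γ → δ-respects π _ _ (words-equal α β γ)) zs) ys) xs ⟩
        triple π ∎

      right-triple-sum : ∀ π → coeff K (bilin K op₃ xs (bilin K op₄ ys zs)) π ≈ triple π
      right-triple-sum π = K.trans (coeff-bilin op₃ xs (bilin K op₄ ys zs) π)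
        (extend-pointwise _ _ (λ α → extend-bilin (λ v → δ π (op₃ α v)) op₄ ys zs) xs)

  P-cong : ∀ σ τ → word σ ≡ word τ → P K σ ≈ᴹ P K τ
  P-cong σ τ σ≡τ π = δ-respects π σ τ σ≡τ

  P-bilin : ∀ op α β → bilin K op (P K α) (P K β) ≈ᴹ P K (op α β)
  P-bilin op α β π with ≡-dec _≟ℕ_ (word (op α β)) (word π)
  ... | yes _ = K.+-congʳ (K.*-identityˡ 1#)
  ... | no  _ = K.refl

  single-term : ∀ k σ xs → ((k , σ) ∷ xs) ≈ᴹ ((k *ₗ P K σ) +ᴹ xs)
  single-term k σ xs π with ≡-dec _≟ℕ_ (word σ) (word π)
  ... | yes _ = K.+-congʳ (K.sym (K.*-identityʳ k))
  ... | no  _ = K.refl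

  module Over  = Bilinear _∘_ (cong₂ _∘w_)
  module Under = Bilinear _•_ (cong₂ _•w_)

  isDuplicial-C⁺ : IsDuplicialAlgebra K (C⁺ K)
  isDuplicial-C⁺ = record
    { isModule   = isModule-C⁺
    ; ≺-cong     = λ {xs} {xs′} {ys} {ys′} → Over.cong-B {xs} {xs′} {ys} {ys′}
    ; ≻-cong     = λ {xs} {xs′} {ys} {ys′} → Under.cong-B {xs} {xs′} {ys} {ys′}
    ; ≺-distribˡ = Over.distribˡ-B
    ; ≺-distribʳ = Over.distribʳ-B
    ; ≺-scaleˡ   = Over.scaleˡ-B
    ; ≺-scaleʳ   = Over.scaleʳ-B
    ; ≻-distribˡ = Under.distribˡ-B
    ; ≻-distribʳ = Under.distribʳ-B
    ; ≻-scaleˡ   = Under.scaleˡ-B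
    ; ≻-scaleʳ   = Under.scaleʳ-B
    ; ≺-assoc    = bilin-assoc _∘_ _∘_ _∘_ _∘_ Words.assoc∘
    ; ≻-assoc    = bilin-assoc _•_ _•_ _•_ _•_ Words.assoc•
    ; ≻≺-assoc   = bilin-assoc _∘_ _•_ _•_ _∘_ Words.assoc•∘
    }

-- Evaluating parking functions as duplicial expressions in an element x.
module Evaluation {c ℓ : Level} (K : Field c ℓ) {a ℓa : Level}
                  (A : DuplicialAlgebra K a ℓa) (x : DuplicialAlgebra.Carrierᴹ A) where

  open import Data.Nat using (ℕ; zero; suc; _<_)
  open import Data.Nat.Properties using (≤-refl; ≤-pred)
  open import Data.List using (List; []; _∷_; length)
  open import Data.Empty using (⊥-elim)
  open import Relation.Nullary using (¬_)
  open import Relation.Binary.PropositionalEquality as ≡ using (_≡_; refl; cong)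
  open Words using (node; split; split-node; node-cover; node-partˡ-shorter; node-partʳ-shorter)

  open DuplicialAlgebra A using (Carrierᴹ; 0ᴹ; _≺_; _≻_)
  open ≡.≡-Reasoning

  -- Evaluating parking functions in A.  The node L R is sent to
  -- φ L ≻ (x ≺ φ R), where an empty L or R is simply omitted.

  leftFactor : (List ℕ → Carrierᴹ) → List ℕ → Carrierᴹ → Carrierᴹ
  leftFactor φ []      y = y
  leftFactor φ (l ∷ L) y = φ (l ∷ L) ≻ y

  rightFactor : (List ℕ → Carrierᴹ) → List ℕ → Carrierᴹ
  rightFactor φ []      = x
  rightFactor φ (r ∷ R) = x ≺ φ (r ∷ R)

  assemble : (List ℕ → Carrierᴹ) → List ℕ × List ℕ → Carrierᴹ
  assemble φ (L , R) = leftFactor φ L (rightFactor φ R)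

  -- recursion on the tree structure, with fuel bounding the depth
  evalWith : ℕ → List ℕ → Carrierᴹ
  evalWith zero    _ = 0ᴹ
  evalWith (suc n) w = assemble (evalWith n) (split w)

  eval : List ℕ → Carrierᴹ
  eval w = evalWith (suc (length w)) w

  -- the values of φ on empty words are never used
  leftFactor-cong : ∀ φ ψ L {y y′} → (¬ L ≡ [] → φ L ≡ ψ L) → y ≡ y′ →
                    leftFactor φ L y ≡ leftFactor ψ L y′
  leftFactor-cong φ ψ []      _     refl = refl
  leftFactor-cong φ ψ (l ∷ L) φL≡ψL refl = cong (_≻ _) (φL≡ψL (λ ()))

  rightFactor-cong : ∀ φ ψ R → (¬ R ≡ [] → φ R ≡ ψ R) → rightFactor φ R ≡ rightFactor ψ R
  rightFactor-cong φ ψ []      _     = refl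
  rightFactor-cong φ ψ (r ∷ R) φR≡ψR = cong (x ≺_) (φR≡ψR (λ ()))

  assemble-cong : ∀ φ ψ L R → (¬ L ≡ [] → φ L ≡ ψ L) → (¬ R ≡ [] → φ R ≡ ψ R) →
                  assemble φ (L , R) ≡ assemble ψ (L , R)
  assemble-cong φ ψ L R φL≡ψL φR≡ψR = leftFactor-cong φ ψ L φL≡ψL (rightFactor-cong φ ψ R φR≡ψR)

  evalWith-node : ∀ n L R → IsNDPF R → evalWith (suc n) (node L R) ≡ assemble (evalWith n) (L , R)
  evalWith-node n L R okR = cong (assemble (evalWith n)) (split-node L R okR)

  enough-fuel : ∀ n m w → IsNDPF w → ¬ w ≡ [] → length w < n → length w < m →
                evalWith n w ≡ evalWith m w
  enough-fuel n       m       []       _  w≢[] _  _  = ⊥-elim (w≢[] refl)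
  enough-fuel (suc n) (suc m) (y ∷ ys) ok _    ln lm with node-cover y ys ok
  ... | L , R , okL , okR , w≡ = begin
    evalWith (suc n) (y ∷ ys)      ≡⟨ cong (evalWith (suc n)) w≡ ⟩
    evalWith (suc n) (node L R)    ≡⟨ evalWith-node n L R okR ⟩
    assemble (evalWith n) (L , R)  ≡⟨ assemble-cong (evalWith n) (evalWith m) L R
                                        (λ L≢[] → enough-fuel n m L okL L≢[] (shorterˡ ln) (shorterˡ lm))
                                        (λ R≢[] → enough-fuel n m R okR R≢[] (shorterʳ ln) (shorterʳ lm)) ⟩
    assemble (evalWith m) (L , R)  ≡⟨ evalWith-node m L R okR ⟨
    evalWith (suc m) (node L R)    ≡⟨ cong (evalWith (suc m)) w≡ ⟨
    evalWith (suc m) (y ∷ ys)      ∎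
    where
      shorterˡ : ∀ {k} → length (y ∷ ys) < suc k → length L < k
      shorterˡ w<k = node-partˡ-shorter L R w≡ (≤-pred w<k)
      shorterʳ : ∀ {k} → length (y ∷ ys) < suc k → length R < k
      shorterʳ w<k = node-partʳ-shorter L R w≡ (≤-pred w<k)

  eval-node : ∀ L R → IsNDPF L → IsNDPF R → eval (node L R) ≡ assemble eval (L , R)
  eval-node L R okL okR = ≡.trans (evalWith-node (length (node L R)) L R okR)
    (assemble-cong _ _ L R
      (λ L≢[] → enough-fuel _ _ L okL L≢[] (node-partˡ-shorter L R refl ≤-refl) ≤-refl)
      (λ R≢[] → enough-fuel _ _ R okR R≢[] (node-partʳ-shorter L R refl ≤-refl) ≤-refl))

  eval-cover : ∀ {w L R} → w ≡ node L R → IsNDPF L → IsNDPF R → eval w ≡ assemble eval (L , R)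
  eval-cover w≡ okL okR = ≡.trans (cong eval w≡) (eval-node _ _ okL okR)

module Universal {c ℓ : Level} (K : Field c ℓ) {a ℓa : Level}
                 (A : DuplicialAlgebra K a ℓa) (x : DuplicialAlgebra.Carrierᴹ A) where

  open import Data.Nat using (suc; _≤_; _<_)
  open import Data.Nat.Properties using (≤-refl; ≤-pred)
  open import Data.List using ([]; _∷_; length)
  open import Data.List.Properties using (++-identityʳ)
  open import Data.Empty using (⊥-elim)
  open import Relation.Nullary using (¬_)
  open import Relation.Binary.PropositionalEquality as ≡ using (_≡_; refl; cong)
  open import Algebra.Module.Morphism.Structures using (module ModuleMorphisms)
  open Words using (node; node-cover; node-partˡ-shorter; node-partʳ-shorter; node-•w; node-∘w;
                    node-as-products; shift-zero)
  open Evaluation K A x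

  private module K = Field K
  open DuplicialAlgebra A

  A-module : Module K.commutativeRing a ℓa
  A-module = record { isModule = isModule }

  open Module A-module using (≈ᴹ-setoid; ≈ᴹ-refl; ≈ᴹ-sym; ≈ᴹ-trans; ≈ᴹ-reflexive; +ᴹ-cong;
                              +ᴹ-identityʳ; *ₗ-identityˡ; *ₗ-*ᵣ-coincident)
  open LinearExtension K A-module using (extend; extend-++; extend-map; extend-negate;
                                         extend-pointwise; extend-respects; module Multiplicative)
  open import Relation.Binary.Reasoning.Setoid ≈ᴹ-setoid

  eval-≡ : ∀ {u v} → u ≡ v → eval u ≈ᴹ eval v
  eval-≡ u≡v = ≈ᴹ-reflexive (cong eval u≡v)

  -- eval turns • into ≻; induction on the length of the right factor,
  -- which is node L R with α • node L R = node (α • L) R.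
  eval-• : ∀ n α β → IsNDPF α → IsNDPF β → ¬ α ≡ [] → ¬ β ≡ [] → length β ≤ n →
           eval (α •w β) ≈ᴹ eval α ≻ eval β
  eval-• n       α []       _   _   _   β≢[] _ = ⊥-elim (β≢[] refl)
  eval-• (suc n) α (b ∷ bs) okα okβ α≢[] _ len with node-cover b bs okβ
  ... | L , R , okL , okR , β≡ = begin
    eval (α •w (b ∷ bs))
      ≈⟨ eval-≡ (≡.trans (cong (α •w_) β≡) (node-•w α L R)) ⟩
    eval (node (α •w L) R)
      ≈⟨ ≈ᴹ-reflexive (eval-node (α •w L) R (•-isNDPF α L okα okL) okR) ⟩
    leftFactor eval (α •w L) r
      ≈⟨ left-• α L α≢[] (λ L≢[] →
           eval-• n α L okα okL α≢[] L≢[] (≤-pred (node-partˡ-shorter L R β≡ len))) ⟩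
    eval α ≻ leftFactor eval L r
      ≈⟨ ≻-cong ≈ᴹ-refl (≈ᴹ-reflexive (eval-cover β≡ okL okR)) ⟨
    eval α ≻ eval (b ∷ bs) ∎
    where
      r : Carrierᴹ
      r = rightFactor eval R

      left-• : ∀ α L → ¬ α ≡ [] → (¬ L ≡ [] → eval (α •w L) ≈ᴹ eval α ≻ eval L) →
               leftFactor eval (α •w L) r ≈ᴹ eval α ≻ leftFactor eval L r
      left-• []      _       α≢[] _   = ⊥-elim (α≢[] refl)
      left-• (a ∷ α) []      _    _   = ≻-cong (eval-≡ (++-identityʳ (a ∷ α))) ≈ᴹ-refl
      left-• (a ∷ α) (l ∷ L) _    ih  = ≈ᴹ-trans (≻-cong (ih (λ ())) ≈ᴹ-refl) (≻-assoc _ _ _)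

  -- eval turns ∘ into ≺; induction on the length of the left factor,
  -- which is node L R with node L R ∘ β = node L (R ∘ β).
  eval-∘ : ∀ n α β → IsNDPF α → IsNDPF β → ¬ α ≡ [] → ¬ β ≡ [] → length α ≤ n →
           eval (α ∘w β) ≈ᴹ eval α ≺ eval β
  eval-∘ n       []       β _   _   α≢[] _ _ = ⊥-elim (α≢[] refl)
  eval-∘ (suc n) (a ∷ as) β okα okβ _ β≢[] len with node-cover a as okα
  ... | L , R , okL , okR , α≡ = begin
    eval ((a ∷ as) ∘w β)
      ≈⟨ eval-≡ (≡.trans (cong (_∘w β) α≡) (node-∘w L R β okL)) ⟩
    eval (node L (R ∘w β))
      ≈⟨ ≈ᴹ-reflexive (eval-node L (R ∘w β) okL (∘-isNDPF R β okR okβ)) ⟩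
    leftFactor eval L (rightFactor eval (R ∘w β))
      ≈⟨ left-cong L (right-∘ R β β≢[] (λ R≢[] →
           eval-∘ n R β okR okβ R≢[] β≢[] (≤-pred (node-partʳ-shorter L R α≡ len)))) ⟩
    leftFactor eval L (rightFactor eval R ≺ eval β)
      ≈⟨ left-≺ L ⟩
    leftFactor eval L (rightFactor eval R) ≺ eval β
      ≈⟨ ≺-cong (≈ᴹ-reflexive (eval-cover α≡ okL okR)) ≈ᴹ-refl ⟨
    eval (a ∷ as) ≺ eval β ∎
    where
      right-∘ : ∀ R β → ¬ β ≡ [] → (¬ R ≡ [] → eval (R ∘w β) ≈ᴹ eval R ≺ eval β) →
                rightFactor eval (R ∘w β) ≈ᴹ rightFactor eval R ≺ eval β
      right-∘ []      []       β≢[] _  = ⊥-elim (β≢[] refl)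
      right-∘ []      (b ∷ bs) _    _  = ≺-cong ≈ᴹ-refl (eval-≡ (shift-zero (b ∷ bs)))
      right-∘ (r ∷ R) β        _    ih =
        ≈ᴹ-trans (≺-cong ≈ᴹ-refl (ih (λ ()))) (≈ᴹ-sym (≺-assoc _ _ _))

      left-cong : ∀ L {y y′} → y ≈ᴹ y′ → leftFactor eval L y ≈ᴹ leftFactor eval L y′
      left-cong []      y≈y′ = y≈y′
      left-cong (l ∷ L) y≈y′ = ≻-cong ≈ᴹ-refl y≈y′

      left-≺ : ∀ L {y z} → leftFactor eval L (y ≺ z) ≈ᴹ leftFactor eval L y ≺ z
      left-≺ []      = ≈ᴹ-refl
      left-≺ (l ∷ L) = ≈ᴹ-sym (≻≺-assoc _ _ _)

  F : NDPF → Carrierᴹ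
  F σ = eval (word σ)

  F-• : ∀ α β → F (α • β) ≈ᴹ F α ≻ F β
  F-• (ndpf u oku u≢[]) (ndpf v okv v≢[]) = eval-• (length v) u v oku okv u≢[] v≢[] ≤-refl

  F-∘ : ∀ α β → F (α ∘ β) ≈ᴹ F α ≺ F β
  F-∘ (ndpf u oku u≢[]) (ndpf v okv v≢[]) = eval-∘ (length u) u v oku okv u≢[] v≢[] ≤-refl

  f : C⁺-Carrier K → Carrierᴹ
  f = extend F

  private
    module Over  = Multiplicative _≺_ ≺-cong ≺-distribˡ ≺-distribʳ ≺-scaleˡ ≺-scaleʳ
    module Under = Multiplicative _≻_ ≻-cong ≻-distribˡ ≻-distribʳ ≻-scaleˡ ≻-scaleʳ

  -- f(P^𝟙) = 1 ·(eval 1) + 0, and eval 1 computes to x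
  f-generator : f (P K 𝟙) ≈ᴹ x
  f-generator = ≈ᴹ-trans (+ᴹ-identityʳ _) (*ₗ-identityˡ x)

  f-morphism : IsDuplicialMorphism K (C⁺ K) rawDuplicial f
  f-morphism = record
    { isLinear = record
      { isBimoduleHomomorphism = record
        { +ᴹ-isGroupHomomorphism = record
          { isMonoidHomomorphism = record
            { isMagmaHomomorphism = record
              { isRelHomomorphism = record
                { cong = λ {xs} {ys} → extend-respects F (λ σ τ → eval-≡) xs ys }
              ; homo = extend-++ F }
            ; ε-homo = ≈ᴹ-refl }
          ; ⁻¹-homo = extend-negate F _ (λ _ _ → K.refl) (λ _ _ → ≈ᴹ-refl) }
        ; *ₗ-homo = λ k → extend-map F F k _ (λ _ _ → K.refl) (λ _ _ → ≈ᴹ-refl)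
        ; *ᵣ-homo = λ k xs → ≈ᴹ-trans (extend-map F F k _ (λ a _ → K.*-comm a k) (λ _ _ → ≈ᴹ-refl) xs)
                                       (*ₗ-*ᵣ-coincident k (f xs)) } }
    ; ≺-homo = Over.extend-multiplicative F _∘_ F-∘
    ; ≻-homo = Under.extend-multiplicative F _•_ F-•
    }

  -- Any duplicial morphism h with h(P^𝟙) ≈ x agrees with f: on basis
  -- elements by induction along the tree structure, then by linearity.
  module Uniqueness (h : C⁺-Carrier K → Carrierᴹ)
                    (h-morphism : IsDuplicialMorphism K (C⁺ K) rawDuplicial h)
                    (h-generator : h (P K 𝟙) ≈ᴹ x) where

    open IsDuplicialMorphism h-morphism using (isLinear; ≺-homo; ≻-homo)
    open ModuleMorphisms.IsModuleHomomorphism isLinear using (⟦⟧-cong; +ᴹ-homo; *ₗ-homo; 0ᴹ-homo)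
    module C⁺ = RawDuplicial (C⁺ K)

    h-P-cong : ∀ σ τ → word σ ≡ word τ → h (P K σ) ≈ᴹ h (P K τ)
    h-P-cong σ τ σ≡τ = ⟦⟧-cong (CPlusStructure.P-cong K σ τ σ≡τ)

    h-P• : ∀ α β → h (P K (α • β)) ≈ᴹ h (P K α) ≻ h (P K β)
    h-P• α β = ≈ᴹ-trans (⟦⟧-cong (λ π → K.sym (CPlusStructure.P-bilin K _•_ α β π))) (≻-homo _ _)

    h-P∘ : ∀ α β → h (P K (α ∘ β)) ≈ᴹ h (P K α) ≺ h (P K β)
    h-P∘ α β = ≈ᴹ-trans (⟦⟧-cong (λ π → K.sym (CPlusStructure.P-bilin K _∘_ α β π))) (≺-homo _ _)

    -- on P^w, by induction along w = node L R = L • (𝟙 ∘ R)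
    h-basis : ∀ n w (ok : IsNDPF w) (w≢[] : ¬ w ≡ []) → length w ≤ n →
              h (P K (ndpf w ok w≢[])) ≈ᴹ eval w
    h-basis n       []       _  w≢[] _   = ⊥-elim (w≢[] refl)
    h-basis (suc n) (y ∷ ys) ok w≢[] len with node-cover y ys ok
    ... | L , R , okL , okR , w≡ = begin
      h (P K (ndpf (y ∷ ys) ok w≢[]))
        ≈⟨ by-shape L R okL okR w≡
             (λ L≢[] → h-basis n L okL L≢[] (≤-pred (node-partˡ-shorter L R w≡ len)))
             (λ R≢[] → h-basis n R okR R≢[] (≤-pred (node-partʳ-shorter L R w≡ len))) ⟩
      assemble eval (L , R)
        ≈⟨ ≈ᴹ-reflexive (eval-cover w≡ okL okR) ⟨
      eval (y ∷ ys) ∎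
      where
        σ : NDPF
        σ = ndpf (y ∷ ys) ok w≢[]

        by-shape : ∀ L R (okL : IsNDPF L) (okR : IsNDPF R) → y ∷ ys ≡ node L R →
                   ((L≢[] : ¬ L ≡ []) → h (P K (ndpf L okL L≢[])) ≈ᴹ eval L) →
                   ((R≢[] : ¬ R ≡ []) → h (P K (ndpf R okR R≢[])) ≈ᴹ eval R) →
                   h (P K σ) ≈ᴹ assemble eval (L , R)
        by-shape []      []      _   _   w≡ _    _    = ≈ᴹ-trans (h-P-cong σ 𝟙 w≡) h-generator
        by-shape []      (r ∷ R) _   okR w≡ _    ih-R = begin
          h (P K σ)                ≈⟨ h-P-cong σ (𝟙 ∘ R̂) w≡ ⟩
          h (P K (𝟙 ∘ R̂))          ≈⟨ h-P∘ 𝟙 R̂ ⟩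
          h (P K 𝟙) ≺ h (P K R̂)    ≈⟨ ≺-cong h-generator (ih-R (λ ())) ⟩
          x ≺ eval (r ∷ R)         ∎
          where
            R̂ : NDPF
            R̂ = ndpf (r ∷ R) okR (λ ())
        by-shape (l ∷ L) []      okL _   w≡ ih-L _    = begin
          h (P K σ)                ≈⟨ h-P-cong σ (L̂ • 𝟙) w≡ ⟩
          h (P K (L̂ • 𝟙))          ≈⟨ h-P• L̂ 𝟙 ⟩
          h (P K L̂) ≻ h (P K 𝟙)    ≈⟨ ≻-cong (ih-L (λ ())) h-generator ⟩
          eval (l ∷ L) ≻ x         ∎
          where
            L̂ : NDPF
            L̂ = ndpf (l ∷ L) okL (λ ())
        by-shape (l ∷ L) (r ∷ R) okL okR w≡ ih-L ih-R = begin
          h (P K σ)                           ≈⟨ h-P-cong σ (L̂ • (𝟙 ∘ R̂))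
                                                   (≡.trans w≡ (node-as-products (l ∷ L) (r ∷ R))) ⟩
          h (P K (L̂ • (𝟙 ∘ R̂)))               ≈⟨ h-P• L̂ (𝟙 ∘ R̂) ⟩
          h (P K L̂) ≻ h (P K (𝟙 ∘ R̂))         ≈⟨ ≻-cong ≈ᴹ-refl (h-P∘ 𝟙 R̂) ⟩
          h (P K L̂) ≻ (h (P K 𝟙) ≺ h (P K R̂)) ≈⟨ ≻-cong (ih-L (λ ())) (≺-cong h-generator (ih-R (λ ()))) ⟩
          eval (l ∷ L) ≻ (x ≺ eval (r ∷ R))   ∎
          where
            L̂ R̂ : NDPF
            L̂ = ndpf (l ∷ L) okL (λ ())
            R̂ = ndpf (r ∷ R) okR (λ ())

    h-linear : ∀ xs → h xs ≈ᴹ extend (λ σ → h (P K σ)) xs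
    h-linear []             = 0ᴹ-homo
    h-linear ((k , σ) ∷ xs) = begin
      h ((k , σ) ∷ xs)               ≈⟨ ⟦⟧-cong (CPlusStructure.single-term K k σ xs) ⟩
      h (k C⁺.*ₗ P K σ C⁺.+ᴹ xs)     ≈⟨ +ᴹ-homo _ xs ⟩
      h (k C⁺.*ₗ P K σ) +ᴹ h xs      ≈⟨ +ᴹ-cong (*ₗ-homo k (P K σ)) (h-linear xs) ⟩
      k *ₗ h (P K σ) +ᴹ extend (λ σ → h (P K σ)) xs ∎

    unique : ∀ xs → h xs ≈ᴹ f xs
    unique xs = ≈ᴹ-trans (h-linear xs) (extend-pointwise _ _ h≈F xs)
      where
        h≈F : ∀ σ → h (P K σ) ≈ᴹ F σ
        h≈F (ndpf w ok w≢[]) = h-basis (length w) w ok w≢[] ≤-refl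

mainTheorem1 : ∀ {c ℓ a ℓa : Level} (K : Field c ℓ) →
    IsDuplicialAlgebra K (C⁺ K) × IsFreeDuplicialOn K (C⁺ K) (P K 𝟙) a ℓa
mainTheorem1 K = CPlusStructure.isDuplicial-C⁺ K , λ A x →
  let open Universal K A x in
  f , f-morphism , f-generator ,
  λ h h-morphism h-generator → Uniqueness.unique h h-morphism h-generator
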